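{- Let $\{[k_i,k_{i+1}):i\in\omega\}$ be an interval partition of $\omega$ (with $k_0<k_1<\cdots$) and let $E$ and $\mathcal{U}$ be non-isomorphic $Q$-points. Then there exist $v\in E$ and $u\in\mathcal{U}$ such that for every $i\in\omega\setminus\{0\}$: if $v\cap[k_i,k_{i+1})\neq\emptyset$, then $u\cap[k_{i-1},k_i)=\emptyset$, $u\cap[k_i,k_{i+1})=\emptyset$, and $u\cap[k_{i+1},k_{i+2})=\emptyset$.
   Context: Ultrafilters are non-principal ultrafilters on $\omega$. An ultrafilter $E$ is a $Q$-point if for every interval partition $\{[k_i,k_{i+1}):i\in\omega\}$ of $\omega$ there is $x\in E$ with $|x\cap[k_i,k_{i+1})|\le1$ for all $i$. Ultrafilters $E$ and $\mathcal{U}$ are isomorphic if there is a permutation $f$ of $\omega$ with $\{f[x]:x\in E\}=\mathcal{U}$. -}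

module Defs where

open import Data.Nat using (ℕ; zero; suc; _≤_; _<_; _≟_)
open import Data.Bool using (Bool; true; false; _∧_; not)
open import Data.Product using (Σ; _×_; ∃; ∃-syntax; _,_)
open import Data.Sum using (_⊎_)
open import Relation.Nullary using (¬_; does)
open import Relation.Binary.PropositionalEquality using (_≡_)
open import Function.Bundles using (_↔_; Inverse)

Subset : Set
Subset = ℕ → Bool

_∈ˢ_ : ℕ → Subset → Set
n ∈ˢ x = x n ≡ true

_⊆ˢ_ : Subset → Subset → Set
x ⊆ˢ y = ∀ n → n ∈ˢ x → n ∈ˢ y

_∩ˢ_ : Subset → Subset → Subset
(x ∩ˢ y) n = x n ∧ y n

∁ : Subset → Subset
∁ x n = not (x n)

∅ˢ : Subset
∅ˢ _ = false

singleton : ℕ → Subset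
singleton m n = does (m ≟ n)

record IsNPUltrafilter (F : Subset → Set) : Set where
  field
    upward       : ∀ {x y} → F x → x ⊆ˢ y → F y
    intersection : ∀ {x y} → F x → F y → F (x ∩ˢ y)
    proper       : ¬ F ∅ˢ
    ultra        : ∀ x → F x ⊎ F (∁ x)
    nonprincipal : ∀ n → ¬ F (singleton n)

-- k₀ < k₁ < ⋯ with k₀ = 0 determines the interval partition
-- { [k i , k (i+1)) : i ∈ ω } of ω.
IsIntervalPartition : (ℕ → ℕ) → Set
IsIntervalPartition k = (k 0 ≡ 0) × (∀ i → k i < k (suc i))

InInterval : (ℕ → ℕ) → ℕ → ℕ → Set
InInterval k i m = (k i ≤ m) × (m < k (suc i))

AtMostOneIn : (ℕ → ℕ) → Subset → ℕ → Set
AtMostOneIn k x i = ∀ m n → InInterval k i m → InInterval k i n →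
                    m ∈ˢ x → n ∈ˢ x → m ≡ n

DisjointFrom : (ℕ → ℕ) → Subset → ℕ → Set
DisjointFrom k x i = ∀ m → InInterval k i m → ¬ (m ∈ˢ x)

Meets : (ℕ → ℕ) → Subset → ℕ → Set
Meets k x i = ∃[ m ] (InInterval k i m × m ∈ˢ x)

IsQPoint : (Subset → Set) → Set
IsQPoint F = IsNPUltrafilter F ×
  (∀ k → IsIntervalPartition k → ∃[ x ] (F x × (∀ i → AtMostOneIn k x i)))

image : ℕ ↔ ℕ → Subset → Subset
image f x n = x (Inverse.from f n)

-- E and U are isomorphic: some permutation f has {f[x] : x ∈ E} = U
-- (equality of subsets of ω being pointwise equality).
Isomorphic : (Subset → Set) → (Subset → Set) → Set
Isomorphic E U = Σ (ℕ ↔ ℕ) λ f →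
  (∀ y → U y → ∃[ x ] (E x × (∀ n → y n ≡ image f x n))) ×
  (∀ y → (∃[ x ] (E x × (∀ n → y n ≡ image f x n))) → U y)

{-# OPTIONS --safe #-}
-- Fix selectors x ∈ E and y ∈ U for an interval partition (Q-points have them).
-- Swapping every point of x with the point of y in the same interval, and
-- fixing all other points, is an involution of ω; it carries E onto U unless
-- some v ∈ E and u ∈ U meet no common interval.  As E ≇ U, such v, u exist for
-- every interval partition.  Apply this to the two partitions obtained from k by
-- merging the intervals 2t, 2t+1, respectively 2t+1, 2t+2: any two points lying
-- in adjacent intervals of k share a block of one of them, so intersecting the
-- two pairs (v, u) gives the theorem.
module Submission where

open import Defs
open import Data.Nat using (ℕ; zero; suc; _≤_; _<_; _≤′_; ≤′-refl; ≤′-step)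
open import Data.Nat.Properties using (≤-refl; ≤-trans; <⇒≤; <-trans; <-≤-trans; <⇒≱; ≤⇒≤′; <-cmp)
open import Data.Bool using (true)
open import Data.Product using (_×_; ∃; ∃-syntax; _,_; proj₁; proj₂)
open import Data.Sum using (_⊎_; inj₁; inj₂)
open import Data.Empty using (⊥-elim)
open import Function using (_∘_; flip)
open import Function.Bundles using (mk↔ₛ′)
open import Relation.Nullary using (¬_; Dec; yes; no)
open import Relation.Nullary.Decidable using (decidable-stable)
open import Relation.Binary using (Rel; IsPartialEquivalence; tri<; tri≈; tri>)
open import Relation.Binary.PropositionalEquality using (_≡_; refl; sym; trans; cong)
open import Axiom.ExcludedMiddle using (ExcludedMiddle)
open import Level using (0ℓ)

∩-∈ˡ : ∀ x y {n} → n ∈ˢ (x ∩ˢ y) → n ∈ˢ x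
∩-∈ˡ x y {n} n∈x∩y with x n
... | true = refl

∩-∈ʳ : ∀ x y {n} → n ∈ˢ (x ∩ˢ y) → n ∈ˢ y
∩-∈ʳ x y {n} n∈x∩y with x n
... | true = n∈x∩y

∁-∉ : ∀ x {n} → n ∈ˢ ∁ x → ¬ n ∈ˢ x
∁-∉ x {n} n∈∁x n∈x with x n
∁-∉ x () n∈x | true

preimage : (ℕ → ℕ) → Subset → Subset
preimage f w n = w (f n)

Separated : Rel ℕ 0ℓ → Subset → Subset → Set
Separated R v u = ∀ {m n} → m ∈ˢ v → n ∈ˢ u → ¬ R m n

Separable : Rel ℕ 0ℓ → (Subset → Set) → (Subset → Set) → Set
Separable R E U = ∃[ v ] ∃[ u ] (E v × U u × Separated R v u)

separable-flip : ∀ {R E U} → Separable (flip R) U E → Separable R E U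
separable-flip (u , v , Uu , Ev , u⊥v) = v , u , Ev , Uu , λ m∈v n∈u → u⊥v n∈u m∈v

separable-⊎ : ∀ {R S E U} → IsNPUltrafilter E → IsNPUltrafilter U →
              Separable R E U → Separable S E U →
              Separable (λ m n → R m n ⊎ S m n) E U
separable-⊎ E-uf U-uf (v , u , Ev , Uu , v⊥u) (v′ , u′ , Ev′ , Uu′ , v′⊥u′) =
  v ∩ˢ v′ , u ∩ˢ u′ ,
  IsNPUltrafilter.intersection E-uf Ev Ev′ , IsNPUltrafilter.intersection U-uf Uu Uu′ ,
  λ { m∈ n∈ (inj₁ r) → v⊥u (∩-∈ˡ v v′ m∈) (∩-∈ˡ u u′ n∈) r
    ; m∈ n∈ (inj₂ s) → v′⊥u′ (∩-∈ʳ v v′ m∈) (∩-∈ʳ u u′ n∈) s }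

IsPartialSelector : Rel ℕ 0ℓ → Subset → Set
IsPartialSelector R x = ∀ {a b} → a ∈ˢ x → b ∈ˢ x → R a b → a ≡ b

isomorphic-by-involution : ∀ {E U} → IsNPUltrafilter U →
  (f : ℕ → ℕ) → (∀ n → f (f n) ≡ n) →
  (∀ {w} → E w → U (preimage f w)) → (∀ {w} → U w → E (preimage f w)) →
  Isomorphic E U
isomorphic-by-involution U-uf f f∘f≗id E→U U→E =
  mk↔ₛ′ f f f∘f≗id f∘f≗id ,
  (λ w Uw → preimage f w , U→E Uw , λ n → cong w (sym (f∘f≗id n))) ,
  (λ { w (w′ , Ew′ , w≗) → IsNPUltrafilter.upward U-uf (E→U Ew′) (λ n → trans (w≗ n)) })

-- For w ∈ E the sets w ∩ x and y ∖ f⁻¹[w ∩ x] are separated, so U cannot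
-- contain the latter.
inseparable⇒preimage∈ : ∀ {R E U x y} → IsNPUltrafilter E → IsNPUltrafilter U →
  E x → U y → (f : ℕ → ℕ) → (∀ {n m} → n ∈ˢ y → m ∈ˢ x → R m n → f n ≡ m) →
  ¬ Separable R E U → ∀ {w} → E w → U (preimage f w)
inseparable⇒preimage∈ {R} {x = x} {y} E-uf U-uf Ex Uy f f-matches ¬sep {w} Ew
  with IsNPUltrafilter.ultra U-uf (preimage f (w ∩ˢ x))
... | inj₁ U-pre = IsNPUltrafilter.upward U-uf U-pre (λ n → ∩-∈ˡ w x)
... | inj₂ U-rest = ⊥-elim (¬sep (w ∩ˢ x , y ∩ˢ rest ,
                          IsNPUltrafilter.intersection E-uf Ew Ex ,
                          IsNPUltrafilter.intersection U-uf Uy U-rest ,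
                          separated))
  where
  rest : Subset
  rest = ∁ (preimage f (w ∩ˢ x))

  separated : Separated R (w ∩ˢ x) (y ∩ˢ rest)
  separated {m} {n} m∈ n∈ Rmn = ∁-∉ (preimage f (w ∩ˢ x)) (∩-∈ʳ y rest n∈) n∈f⁻¹[w∩x]
    where
    n∈f⁻¹[w∩x] : n ∈ˢ preimage f (w ∩ˢ x)
    n∈f⁻¹[w∩x] rewrite f-matches (∩-∈ˡ y rest n∈) (∩-∈ʳ w x m∈) Rmn = m∈

module Swap (em : ExcludedMiddle 0ℓ) {R : Rel ℕ 0ℓ} (R-per : IsPartialEquivalence R)
            {x y : Subset} (x-sel : IsPartialSelector R x) (y-sel : IsPartialSelector R y) where

  open IsPartialEquivalence R-per renaming (sym to R-sym; trans to R-trans)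

  Partner : ℕ → ℕ → Set
  Partner n m = (n ∈ˢ x × m ∈ˢ y × R n m) ⊎ (n ∈ˢ y × m ∈ˢ x × R m n)

  partner-sym : ∀ {n m} → Partner n m → Partner m n
  partner-sym (inj₁ (n∈x , m∈y , r)) = inj₂ (m∈y , n∈x , r)
  partner-sym (inj₂ (n∈y , m∈x , r)) = inj₁ (m∈x , n∈y , r)

  partner-unique : ∀ {n m m′} → Partner n m → Partner n m′ → m ≡ m′
  partner-unique (inj₁ (_ , m∈y , r)) (inj₁ (_ , m′∈y , r′)) = y-sel m∈y m′∈y (R-trans (R-sym r) r′)
  partner-unique (inj₁ (n∈x , m∈y , r)) (inj₂ (n∈y , m′∈x , r′)) =
    trans (y-sel m∈y n∈y (R-sym r)) (x-sel n∈x m′∈x (R-sym r′))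
  partner-unique (inj₂ (n∈y , m∈x , r)) (inj₁ (n∈x , m′∈y , r′)) =
    trans (x-sel m∈x n∈x r) (y-sel n∈y m′∈y r′)
  partner-unique (inj₂ (_ , m∈x , r)) (inj₂ (_ , m′∈x , r′)) = x-sel m∈x m′∈x (R-trans r (R-sym r′))

  partnerOrSelf : ∀ n → Dec (∃ (Partner n)) → ℕ
  partnerOrSelf n (yes (m , _)) = m
  partnerOrSelf n (no _)        = n

  swap : ℕ → ℕ
  swap n = partnerOrSelf n em

  swap-spec : ∀ n → Partner n (swap n) ⊎ swap n ≡ n
  swap-spec n = spec em
    where
    spec : (d : Dec (∃ (Partner n))) → Partner n (partnerOrSelf n d) ⊎ partnerOrSelf n d ≡ n
    spec (yes (_ , p)) = inj₁ p
    spec (no _)        = inj₂ refl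

  swap-partner : ∀ {n m} → Partner n m → swap n ≡ m
  swap-partner {n} p = fromPartner em
    where
    fromPartner : (d : Dec (∃ (Partner n))) → partnerOrSelf n d ≡ _
    fromPartner (yes (_ , p′)) = partner-unique p′ p
    fromPartner (no ∄)         = ⊥-elim (∄ (_ , p))

  swap-involutive : ∀ n → swap (swap n) ≡ n
  swap-involutive n with swap-spec n
  ... | inj₁ p    = swap-partner (partner-sym p)
  ... | inj₂ same = trans (cong swap same) same

  inseparable⇒isomorphic : ∀ {E U} → IsNPUltrafilter E → IsNPUltrafilter U →
    E x → U y → ¬ Separable R E U → Isomorphic E U
  inseparable⇒isomorphic E-uf U-uf Ex Uy ¬sep =
    isomorphic-by-involution U-uf swap swap-involutive
      (inseparable⇒preimage∈ E-uf U-uf Ex Uy swap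
        (λ n∈y m∈x r → swap-partner (inj₂ (n∈y , m∈x , r))) ¬sep)
      (inseparable⇒preimage∈ U-uf E-uf Uy Ex swap
        (λ n∈x m∈y r → swap-partner (inj₁ (n∈x , m∈y , r))) (¬sep ∘ separable-flip))

StrictlyIncreasing : (ℕ → ℕ) → Set
StrictlyIncreasing k = ∀ i → k i < k (suc i)

increasing-mono : ∀ {k i j} → StrictlyIncreasing k → i ≤′ j → k i ≤ k j
increasing-mono inc ≤′-refl      = ≤-refl
increasing-mono inc (≤′-step i≤j) = ≤-trans (increasing-mono inc i≤j) (<⇒≤ (inc _))

InInterval-<-next : ∀ {k i j m} → StrictlyIncreasing k → i < j → InInterval k i m → m < k j
InInterval-<-next inc i<j (_ , m<) = <-≤-trans m< (increasing-mono inc (≤⇒≤′ i<j))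

InInterval-unique : ∀ {k i j m} → StrictlyIncreasing k →
                    InInterval k i m → InInterval k j m → i ≡ j
InInterval-unique {i = i} {j} inc m∈i m∈j with <-cmp i j
... | tri< i<j _ _ = ⊥-elim (<⇒≱ (InInterval-<-next inc i<j m∈i) (proj₁ m∈j))
... | tri≈ _ i≡j _ = i≡j
... | tri> _ _ j<i = ⊥-elim (<⇒≱ (InInterval-<-next inc j<i m∈j) (proj₁ m∈i))

SameInterval : (ℕ → ℕ) → Rel ℕ 0ℓ
SameInterval k m n = ∃[ i ] (InInterval k i m × InInterval k i n)

sameInterval-isPartialEquivalence : ∀ {k} → StrictlyIncreasing k →
                                    IsPartialEquivalence (SameInterval k)
sameInterval-isPartialEquivalence inc = record
  { sym   = λ { (i , m∈ , n∈) → i , n∈ , m∈ }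
  ; trans = λ { (i , l∈ , m∈) (j , m∈′ , n∈) → transport (InInterval-unique inc m∈ m∈′) l∈ n∈ }
  }
  where
  transport : ∀ {k i j l n} → i ≡ j → InInterval k i l → InInterval k j n → SameInterval k l n
  transport refl l∈ n∈ = _ , l∈ , n∈

atMostOneIn⇒isPartialSelector : ∀ {k x} → (∀ i → AtMostOneIn k x i) →
                                 IsPartialSelector (SameInterval k) x
atMostOneIn⇒isPartialSelector one a∈x b∈x (i , a∈ , b∈) = one i _ _ a∈ b∈ a∈x b∈x

qPoint-selector : ∀ {F k} → IsQPoint F → IsIntervalPartition k →
                  ∃[ x ] (F x × IsPartialSelector (SameInterval k) x)
qPoint-selector (_ , select) k-part with select _ k-part
... | x , Fx , one = x , Fx , atMostOneIn⇒isPartialSelector one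

nonIsomorphic⇒separable : ExcludedMiddle 0ℓ → ∀ {E U k} → IsQPoint E → IsQPoint U →
  ¬ Isomorphic E U → IsIntervalPartition k → Separable (SameInterval k) E U
nonIsomorphic⇒separable em E-q U-q E≇U k-part@(_ , k-inc)
  with qPoint-selector E-q k-part | qPoint-selector U-q k-part
... | x , Ex , x-sel | y , Uy , y-sel = decidable-stable em λ ¬sep →
  E≇U (Swap.inseparable⇒isomorphic em (sameInterval-isPartialEquivalence k-inc) x-sel y-sel
         (proj₁ E-q) (proj₁ U-q) Ex Uy ¬sep)

double : ℕ → ℕ
double zero    = zero
double (suc t) = suc (suc (double t))

data Halving : ℕ → Set where
  even : ∀ t → Halving (double t)
  odd  : ∀ t → Halving (suc (double t))

halve : ∀ i → Halving i
halve zero = even zero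
halve (suc i) with halve i
... | even t = odd t
... | odd t  = even (suc t)

evenBlocks : (ℕ → ℕ) → ℕ → ℕ
evenBlocks k t = k (double t)

oddBlocks : (ℕ → ℕ) → ℕ → ℕ
oddBlocks k zero    = k zero
oddBlocks k (suc t) = k (suc (double t))

evenBlocks-isIntervalPartition : ∀ {k} → IsIntervalPartition k → IsIntervalPartition (evenBlocks k)
evenBlocks-isIntervalPartition (k0≡0 , inc) = k0≡0 , λ t → <-trans (inc _) (inc _)

oddBlocks-isIntervalPartition : ∀ {k} → IsIntervalPartition k → IsIntervalPartition (oddBlocks k)
oddBlocks-isIntervalPartition (k0≡0 , inc) = k0≡0 , λ { zero → inc 0 ; (suc t) → <-trans (inc _) (inc _) }

InInterval-merge : ∀ {k i m} → StrictlyIncreasing k →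
                   InInterval k i m ⊎ InInterval k (suc i) m → k i ≤ m × m < k (suc (suc i))
InInterval-merge inc (inj₁ (ki≤m , m<)) = ki≤m , <-trans m< (inc _)
InInterval-merge inc (inj₂ (ki+1≤m , m<)) = ≤-trans (<⇒≤ (inc _)) ki+1≤m , m<

Near : (ℕ → ℕ) → Rel ℕ 0ℓ
Near k m n = SameInterval (evenBlocks k) m n ⊎ SameInterval (oddBlocks k) m n

adjacent-near : ∀ {k m n} → StrictlyIncreasing k → ∀ i →
                InInterval k i m ⊎ InInterval k (suc i) m →
                InInterval k i n ⊎ InInterval k (suc i) n → Near k m n
adjacent-near inc i m∈ n∈ with halve i
... | even t = inj₁ (t , InInterval-merge inc m∈ , InInterval-merge inc n∈)
... | odd t  = inj₂ (suc t , InInterval-merge inc m∈ , InInterval-merge inc n∈)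

near-separated⇒disjoint : ∀ {k v u} → StrictlyIncreasing k → Separated (Near k) v u →
  ∀ j → Meets k v (suc j) →
  DisjointFrom k u j × DisjointFrom k u (suc j) × DisjointFrom k u (suc (suc j))
near-separated⇒disjoint inc v⊥u j (m , m∈j+1 , m∈v) =
  (λ n n∈j n∈u → v⊥u m∈v n∈u (adjacent-near inc j (inj₂ m∈j+1) (inj₁ n∈j))) ,
  (λ n n∈j+1 n∈u → v⊥u m∈v n∈u (adjacent-near inc (suc j) (inj₁ m∈j+1) (inj₁ n∈j+1))) ,
  (λ n n∈j+2 n∈u → v⊥u m∈v n∈u (adjacent-near inc (suc j) (inj₁ m∈j+1) (inj₂ n∈j+2)))

mainTheorem4 : ExcludedMiddle 0ℓ →
    (k : ℕ → ℕ) → IsIntervalPartition k →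
    (E U : Subset → Set) → IsQPoint E → IsQPoint U → ¬ Isomorphic E U →
    ∃[ v ] ∃[ u ] (E v × U u ×
      (∀ j → Meets k v (suc j) →
        DisjointFrom k u j × DisjointFrom k u (suc j) × DisjointFrom k u (suc (suc j))))
mainTheorem4 em k k-part E U E-q U-q E≇U
  with separable-⊎ (proj₁ E-q) (proj₁ U-q)
         (nonIsomorphic⇒separable em E-q U-q E≇U (evenBlocks-isIntervalPartition k-part))
         (nonIsomorphic⇒separable em E-q U-q E≇U (oddBlocks-isIntervalPartition k-part))
... | v , u , Ev , Uu , v⊥u = v , u , Ev , Uu , near-separated⇒disjoint (proj₂ k-part) v⊥u
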